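{- Let $G=G(A,B)$ be an irreducible graph with respect to a hereditary class $\mathcal{X}\subseteq Free(\{P_3+P_2\})$, with associated partition $A=A_1\cup A_2\cup A_3$, and let $\mathcal{K}$ be the set of connected components of $G[A_1]$. Then either $A_1$ is independent, or $$\gamma''(G)=\min_{K\in\mathcal{K},\ N_B(V(K)\cup A_2\cup A_3)=B}\gamma''(G_K),$$ where $G_K=G[V(K)\cup A_2\cup A_3\cup B]$ with partition $(V(K)\cup A_2\cup A_3,\,B)$.
   Context: $P_3+P_2$ is the disjoint union of paths on 3 and 2 vertices; $Free(\mathcal{F})$ is the class of graphs with no induced subgraph isomorphic to a member of $\mathcal{F}$; a class is hereditary if closed under vertex deletion. A graph $G$ with a partition $V(G)=A\cup B$ (written $G(A,B)$) is irreducible with respect to $\mathcal{X}$ if: $G\in\mathcal{X}$; $B$ is independent; no vertex of $B$ has degree one; there are no two distinct $u,v\in A$ with $N(u)\setminus A\subseteq N(v)\setminus A$; no vertex of $B$ is adjacent to all vertices of $A$; and $A$ is partitioned into (possibly empty) sets $A_1,A_2,A_3$ such that adding two new vertices $x,y$ and all edges $xx'$ for $x'\in A_1\cup A_3$ and $yy'$ for $y'\in A_2\cup A_3$ yields a graph $G'\in\mathcal{X}$. $N_B(a)=N(a)\cap B$, $N_B(A')=\bigcup_{a\in A'}N_B(a)$. For a graph with vertex partition $(A,B)$, $\gamma''$ is the minimum cardinality of a subset of $A$ such that every vertex of $B$ has a neighbor in it. -}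

module Defs where

open import Data.Nat using (ℕ; zero; suc; _≤_)
open import Data.Fin using (Fin; zero; suc)
open import Data.Fin.Subset using (Subset; _∈_; ∣_∣)
open import Data.Bool using (Bool; true; false; _∨_; if_then_else_)
open import Data.Bool.Properties using (∨-comm)
open import Data.List using (List; map; allFin)
open import Data.Nat.ListAction using (sum)
open import Data.Product using (Σ; ∃; _×_; _,_)
open import Data.Sum using (_⊎_)
open import Data.Empty using (⊥)
open import Data.Unit using (⊤)
open import Relation.Nullary using (¬_)
open import Relation.Binary.PropositionalEquality using (_≡_; _≢_; refl)

record Graph : Set where
  field
    n        : ℕ
    adj      : Fin n → Fin n → Bool
    adj-sym  : ∀ u v → adj u v ≡ adj v u
    loopless : ∀ v → adj v v ≡ false
open Graph public

_≤ᵢ_ : Graph → Graph → Set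
H ≤ᵢ G = Σ (Fin (n H) → Fin (n G)) λ f →
           (∀ {x y} → f x ≡ f y → x ≡ y) ×
           (∀ u v → adj H u v ≡ adj G (f u) (f v))

GraphClass : Set₁
GraphClass = Graph → Set

Hereditary : GraphClass → Set
Hereditary X = ∀ G H → H ≤ᵢ G → X G → X H

Free₁ : Graph → GraphClass
Free₁ F G = ¬ (F ≤ᵢ G)

_⊆ᶜ_ : GraphClass → GraphClass → Set
X ⊆ᶜ Y = ∀ G → X G → Y G

-- The graph P₃ + P₂ : vertices 0-1-2 form a path, 3-4 an edge

private
  e5 : Fin 5 → Fin 5 → Bool
  e5 zero (suc zero) = true
  e5 (suc zero) (suc (suc zero)) = true
  e5 (suc (suc (suc zero))) (suc (suc (suc (suc zero)))) = true
  e5 _ _ = false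

  a5 : Fin 5 → Fin 5 → Bool
  a5 u v = e5 u v ∨ e5 v u

  a5-loop : ∀ v → a5 v v ≡ false
  a5-loop zero = refl
  a5-loop (suc zero) = refl
  a5-loop (suc (suc zero)) = refl
  a5-loop (suc (suc (suc zero))) = refl
  a5-loop (suc (suc (suc (suc zero)))) = refl

P₃+P₂ : Graph
P₃+P₂ = record { n = 5 ; adj = a5 ; adj-sym = λ u v → ∨-comm (e5 u v) (e5 v u)
               ; loopless = a5-loop }

deg : (G : Graph) → Fin (n G) → ℕ
deg G v = sum (map (λ u → if adj G v u then 1 else 0) (allFin (n G)))

-- Labelled partition V(G) = A ∪ B with A = A₁ ∪ A₂ ∪ A₃

data Lab : Set where
  a₁ a₂ a₃ lB : Lab

module _ (G : Graph) (lab : Fin (n G) → Lab) where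

  InB : Fin (n G) → Set
  InB v = lab v ≡ lB

  InA : Fin (n G) → Set
  InA v = ¬ InB v

  InA₁ : Fin (n G) → Set
  InA₁ v = lab v ≡ a₁

-- The graph G' : G plus new vertices x (= zero) and y (= suc zero),
-- x adjacent to A₁ ∪ A₃, y adjacent to A₂ ∪ A₃ (x, y non-adjacent).

toX : Lab → Bool
toX a₁ = true
toX a₂ = false
toX a₃ = true
toX lB = false

toY : Lab → Bool
toY a₁ = false
toY a₂ = true
toY a₃ = true
toY lB = false

module _ (G : Graph) (lab : Fin (n G) → Lab) where
  private
    ext : Fin (suc (suc (n G))) → Fin (suc (suc (n G))) → Bool
    ext zero zero = false
    ext zero (suc zero) = false
    ext zero (suc (suc v)) = toX (lab v)
    ext (suc zero) zero = false
    ext (suc zero) (suc zero) = false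
    ext (suc zero) (suc (suc v)) = toY (lab v)
    ext (suc (suc u)) zero = toX (lab u)
    ext (suc (suc u)) (suc zero) = toY (lab u)
    ext (suc (suc u)) (suc (suc v)) = adj G u v

    ext-sym : ∀ u v → ext u v ≡ ext v u
    ext-sym zero zero = refl
    ext-sym zero (suc zero) = refl
    ext-sym zero (suc (suc v)) = refl
    ext-sym (suc zero) zero = refl
    ext-sym (suc zero) (suc zero) = refl
    ext-sym (suc zero) (suc (suc v)) = refl
    ext-sym (suc (suc u)) zero = refl
    ext-sym (suc (suc u)) (suc zero) = refl
    ext-sym (suc (suc u)) (suc (suc v)) = adj-sym G u v

    ext-loop : ∀ v → ext v v ≡ false
    ext-loop zero = refl
    ext-loop (suc zero) = refl
    ext-loop (suc (suc v)) = loopless G v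

  extendXY : Graph
  extendXY = record { n = suc (suc (n G)) ; adj = ext ; adj-sym = ext-sym
                    ; loopless = ext-loop }

record IrreducibleVia (X : GraphClass) (G : Graph) (lab : Fin (n G) → Lab) : Set where
  field
    inX        : X G
    B-indep    : ∀ u v → InB G lab u → InB G lab v → adj G u v ≡ false
    B-deg≠1    : ∀ v → InB G lab v → ¬ (deg G v ≡ 1)
    A-noninc   : ∀ u v → InA G lab u → InA G lab v → u ≢ v →
                 ¬ (∀ w → ¬ InA G lab w → adj G u w ≡ true → adj G v w ≡ true)
    B-nonfull  : ∀ v → InB G lab v → ¬ (∀ a → InA G lab a → adj G v a ≡ true)
    ext-inX    : X (extendXY G lab)

data ℕ∞ : Set where
  fin : ℕ → ℕ∞
  ∞   : ℕ∞

data _≤∞_ : ℕ∞ → ℕ∞ → Set where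
  fin≤fin : ∀ {m k} → m ≤ k → fin m ≤∞ fin k
  _≤∞∞    : ∀ x → x ≤∞ ∞

-- m is the minimum of the set {x | P x} (minimum of the empty set is ∞)
IsMinimum : (ℕ∞ → Set) → ℕ∞ → Set
IsMinimum P m = (∀ x → P x → m ≤∞ x) × (P m ⊎ m ≡ ∞)

-- γ'' of the induced subgraph G[A' ∪ B'] with partition (A', B'):
-- minimum size of S ⊆ A' such that each vertex of B' has a neighbour in S

module _ (G : Graph) where

  Dominates : (Fin (n G) → Set) → Subset (n G) → Set
  Dominates B' S = ∀ v → B' v → ∃ λ a → a ∈ S × adj G a v ≡ true

  γ''-candidates : (A' B' : Fin (n G) → Set) → ℕ∞ → Set
  γ''-candidates A' B' x =
    ∃ λ (S : Subset (n G)) → (∀ a → a ∈ S → A' a) × Dominates B' S × x ≡ fin ∣ S ∣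

  IsGamma'' : (A' B' : Fin (n G) → Set) → ℕ∞ → Set
  IsGamma'' A' B' g = IsMinimum (γ''-candidates A' B') g

  -- N_B(X') = B (as sets), where N_B(X') = ⋃_{a ∈ X'} N(a) ∩ B
  N-in : (B' X' : Fin (n G) → Set) → Fin (n G) → Set
  N-in B' X' v = B' v × ∃ λ a → X' a × adj G a v ≡ true

  CoversAll : (B' X' : Fin (n G) → Set) → Set
  CoversAll B' X' = ∀ v → (N-in B' X' v → B' v) × (B' v → N-in B' X' v)

  -- walks all of whose vertices after the first lie in P
  data Reach (P : Fin (n G) → Set) : Fin (n G) → Fin (n G) → Set where
    here : ∀ {u} → Reach P u u
    step : ∀ {u v w} → adj G u v ≡ true → P v → Reach P v w → Reach P u w

  IsComponentOf : (P : Fin (n G) → Set) → Subset (n G) → Set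
  IsComponentOf P C =
    (∀ v → v ∈ C → P v) ×
    (∃ λ v → v ∈ C) ×
    (∀ u v → u ∈ C → v ∈ C → Reach P u v) ×
    (∀ u v → u ∈ C → P v → adj G u v ≡ true → v ∈ C)

module _ (G : Graph) (lab : Fin (n G) → Lab) where

  A₁-Independent : Set
  A₁-Independent = ∀ u v → InA₁ G lab u → InA₁ G lab v → adj G u v ≡ false

  AK : Subset (n G) → Fin (n G) → Set
  AK K v = v ∈ K ⊎ lab v ≡ a₂ ⊎ lab v ≡ a₃

  ComponentValues : ℕ∞ → Set
  ComponentValues x =
    ∃ λ (K : Subset (n G)) → IsComponentOf G (InA₁ G lab) K ×
      CoversAll G (InB G lab) (AK K) × IsGamma'' G (AK K) (InB G lab) x

module Submission where

-- Every G_K-solution is a G-solution, so γ''(G) is a lower bound.  For the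
-- converse take a smallest set S ⊆ A dominating B.  The heart of the proof is
-- the edge lemma: if uv is an edge of G[A] and a ∈ A sees neither u nor v, then
-- u or v sees every B-neighbour of a (otherwise B-independence and the
-- private B-neighbours granted by irreducibility produce an induced P₃+P₂).
-- Vertices of A₁ outside a component K see no vertex of K, so for an edge uv
-- of K the set (S ∩ (V(K) ∪ A₂ ∪ A₃)) ∪ {u,v} still dominates B.  Choosing K
-- and uv suitably (an edge at a vertex of S, or any edge when S meets A₁ in at
-- least two isolated vertices) this set is no larger than S, so it witnesses
-- γ''(G_K) = γ''(G); the remaining cases need no exchange at all.

open import Defs
open import Data.Nat using (suc; _+_; _≤_; _<_; z≤n; s≤s)
open import Data.Nat.Properties
  using (≤-trans; ≤-reflexive; ≤-antisym; +-suc; +-comm; +-monoʳ-≤; n≤1+n; ≮⇒≥; _<?_)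
open import Data.Nat.Induction using (<-wellFounded)
open import Data.Fin using (Fin; zero; suc)
open import Data.Fin.Properties using (any?; all?) renaming (_≟_ to _≟ᶠ_)
open import Data.Fin.Subset using (Subset; inside; outside; _∈_; _∉_; _⊆_; ∣_∣; _∪_; _∩_; _-_; ⁅_⁆)
open import Data.Fin.Subset.Properties
  using (_∈?_; anySubset?; ∣⁅x⁆∣≡1; x∈⁅x⁆; x∈⁅y⁆⇒x≡y; x∈p∩q⁺; x∈p∩q⁻; x∈p∪q⁺; x∈p∪q⁻;
         x∈p∧x≢y⇒x∈p-y; x∈p⇒∣p-x∣<∣p∣; p⊆q⇒∣p∣≤∣q∣; p⊂q⇒∣p∣<∣q∣)
open import Data.Fin.Subset.Induction using (⊃-wellFounded)
open import Data.Vec using (tabulate; _∷_; [])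
open import Data.Vec.Properties using (lookup∘tabulate; lookup⇒[]=; []=⇒lookup)
open import Data.Bool using (true; false)
open import Data.Bool.Properties using (¬-not) renaming (_≟_ to _≟ᵇ_)
open import Data.Product using (Σ; ∃; _×_; _,_; proj₁; proj₂)
open import Data.Sum using (_⊎_; inj₁; inj₂)
open import Data.Empty using (⊥-elim)
open import Induction.WellFounded using (Acc; acc)
open import Relation.Nullary using (¬_; Dec; yes; no; does; contradiction)
open import Relation.Nullary.Decidable using (_×-dec_; _⊎-dec_; _→-dec_; ¬?; dec-true; decidable-stable)
open import Relation.Unary using (Decidable)
open import Relation.Binary.PropositionalEquality using (_≡_; _≢_; refl; sym; trans; cong)

⟦_⟧ : ∀ {m} {P : Fin m → Set} → Decidable P → Subset m
⟦ P? ⟧ = tabulate (λ x → does (P? x))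

∈⟦⟧⁺ : ∀ {m} {P : Fin m → Set} (P? : Decidable P) {x} → P x → x ∈ ⟦ P? ⟧
∈⟦⟧⁺ P? {x} px = lookup⇒[]= x ⟦ P? ⟧ (trans (lookup∘tabulate _ x) (dec-true (P? x) px))

∈⟦⟧⁻ : ∀ {m} {P : Fin m → Set} (P? : Decidable P) {x} → x ∈ ⟦ P? ⟧ → P x
∈⟦⟧⁻ P? {x} x∈ = witness (P? x) (trans (sym (lookup∘tabulate _ x)) ([]=⇒lookup x∈))
  where
  witness : ∀ {A : Set} (a? : Dec A) → does a? ≡ true → A
  witness (yes a) _ = a
  witness (no _) ()

∣p∪q∣≤∣p∣+∣q∣ : ∀ {m} (p q : Subset m) → ∣ p ∪ q ∣ ≤ ∣ p ∣ + ∣ q ∣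
∣p∪q∣≤∣p∣+∣q∣ [] [] = z≤n
∣p∪q∣≤∣p∣+∣q∣ (inside ∷ p) (inside ∷ q) =
  s≤s (≤-trans (∣p∪q∣≤∣p∣+∣q∣ p q) (+-monoʳ-≤ ∣ p ∣ (n≤1+n ∣ q ∣)))
∣p∪q∣≤∣p∣+∣q∣ (inside ∷ p) (outside ∷ q) = s≤s (∣p∪q∣≤∣p∣+∣q∣ p q)
∣p∪q∣≤∣p∣+∣q∣ (outside ∷ p) (inside ∷ q) =
  ≤-trans (s≤s (∣p∪q∣≤∣p∣+∣q∣ p q)) (≤-reflexive (sym (+-suc ∣ p ∣ ∣ q ∣)))
∣p∪q∣≤∣p∣+∣q∣ (outside ∷ p) (outside ∷ q) = ∣p∪q∣≤∣p∣+∣q∣ p q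

∣p∪⁅x⁆∣≤1+∣p∣ : ∀ {m} (p : Subset m) x → ∣ p ∪ ⁅ x ⁆ ∣ ≤ suc ∣ p ∣
∣p∪⁅x⁆∣≤1+∣p∣ p x =
  ≤-trans (∣p∪q∣≤∣p∣+∣q∣ p ⁅ x ⁆)
          (≤-reflexive (trans (cong (∣ p ∣ +_) (∣⁅x⁆∣≡1 x)) (+-comm ∣ p ∣ 1)))

∈∪⁅⁆⁻ : ∀ {m} (p : Subset m) {x y} → x ∈ p ∪ ⁅ y ⁆ → x ∈ p ⊎ x ≡ y
∈∪⁅⁆⁻ p {y = y} x∈ with x∈p∪q⁻ p ⁅ y ⁆ x∈
... | inj₁ x∈p = inj₁ x∈p
... | inj₂ x∈y = inj₂ (x∈⁅y⁆⇒x≡y y x∈y)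

2+∣p∣≤∣q∣ : ∀ {m} {p q : Subset m} {x y} → p ⊆ q → x ≢ y → x ∈ q → y ∈ q → x ∉ p → y ∉ p →
            2 + ∣ p ∣ ≤ ∣ q ∣
2+∣p∣≤∣q∣ {p = p} {q} {x} {y} p⊆q x≢y x∈q y∈q x∉p y∉p =
  ≤-trans (s≤s (s≤s (p⊆q⇒∣p∣≤∣q∣ p⊆q-x-y)))
          (≤-trans (s≤s (x∈p⇒∣p-x∣<∣p∣ y∈q-x)) (x∈p⇒∣p-x∣<∣p∣ x∈q))
  where
  y∈q-x : y ∈ q - x
  y∈q-x = x∈p∧x≢y⇒x∈p-y y∈q (λ y≡x → x≢y (sym y≡x))
  p⊆q-x-y : p ⊆ (q - x) - y
  p⊆q-x-y z∈p = x∈p∧x≢y⇒x∈p-y (x∈p∧x≢y⇒x∈p-y (p⊆q z∈p) λ { refl → x∉p z∈p })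
                              λ { refl → y∉p z∈p }

stabilise : ∀ {m} (f : Subset m → Subset m) → (∀ T → T ⊆ f T) →
            (Inv : Subset m → Set) → (∀ {T} → Inv T → Inv (f T)) →
            ∀ T → Inv T → Σ (Subset m) λ K → Inv K × f K ⊆ K
stabilise f inflationary Inv preserved T inv = go T inv (⊃-wellFounded T)
  where
  go : ∀ T → Inv T → Acc _ T → Σ _ λ K → Inv K × f K ⊆ K
  go T inv (acc smaller) with any? (λ x → x ∈? f T ×-dec ¬? (x ∈? T))
  ... | yes (x , x∈fT , x∉T) = go (f T) (preserved inv) (smaller ((λ {y} → inflationary T {y}) , x , x∈fT , x∉T))
  ... | no none = T , inv , λ {x} x∈fT → decidable-stable (x ∈? T) (λ x∉T → none (x , x∈fT , x∉T))

least-witness : ∀ {m} {P : Subset m → Set} → Decidable P →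
                (∀ S → ¬ P S) ⊎ (Σ (Subset m) λ S → P S × (∀ T → P T → ∣ S ∣ ≤ ∣ T ∣))
least-witness {m} {P} P? with anySubset? P?
... | no none = inj₁ λ S pS → none (S , pS)
... | yes (S , pS) = inj₂ (shrink S pS (<-wellFounded ∣ S ∣))
  where
  shrink : ∀ S → P S → Acc _<_ ∣ S ∣ → Σ (Subset m) λ S' → P S' × (∀ T → P T → ∣ S' ∣ ≤ ∣ T ∣)
  shrink S pS (acc smaller) with anySubset? (λ T → P? T ×-dec (∣ T ∣ <? ∣ S ∣))
  ... | yes (T , pT , T<S) = shrink T pT (smaller T<S)
  ... | no none = S , pS , λ T pT → ≮⇒≥ (λ T<S → none (T , pT , T<S))

module _ (G : Graph) where

  adjacent⇒distinct : ∀ {u v} → adj G u v ≡ true → u ≢ v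
  adjacent⇒distinct {u} uv refl = contradiction (trans (sym uv) (loopless G u)) λ ()

  separated⇒distinct : ∀ {a b w} → adj G a w ≡ false → adj G b w ≡ true → a ≢ b
  separated⇒distinct aw bw refl = contradiction (trans (sym aw) bw) λ ()

  flip : ∀ {u v b} → adj G u v ≡ b → adj G v u ≡ b
  flip {u} {v} e = trans (adj-sym G v u) e

  induced-P₃+P₂ : (p q r s t : Fin (n G)) → p ≢ r →
                  adj G p q ≡ true → adj G q r ≡ true → adj G p r ≡ false → adj G s t ≡ true →
                  adj G p s ≡ false → adj G p t ≡ false → adj G q s ≡ false → adj G q t ≡ false →
                  adj G r s ≡ false → adj G r t ≡ false → P₃+P₂ ≤ᵢ G
  induced-P₃+P₂ p q r s t p≢r pq qr pr st ps pt qs qt rs rt = f , injective , preserves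
    where
    f : Fin 5 → Fin (n G)
    f zero = p
    f (suc zero) = q
    f (suc (suc zero)) = r
    f (suc (suc (suc zero))) = s
    f (suc (suc (suc (suc zero)))) = t

    injective : ∀ {x y} → f x ≡ f y → x ≡ y
    injective {zero} {zero} _ = refl
    injective {zero} {suc zero} e = ⊥-elim (adjacent⇒distinct pq e)
    injective {zero} {suc (suc zero)} e = ⊥-elim (p≢r e)
    injective {zero} {suc (suc (suc zero))} e = ⊥-elim (separated⇒distinct pt st e)
    injective {zero} {suc (suc (suc (suc zero)))} e = ⊥-elim (separated⇒distinct ps (flip st) e)
    injective {suc zero} {zero} e = ⊥-elim (adjacent⇒distinct pq (sym e))
    injective {suc zero} {suc zero} _ = refl
    injective {suc zero} {suc (suc zero)} e = ⊥-elim (adjacent⇒distinct qr e)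
    injective {suc zero} {suc (suc (suc zero))} e = ⊥-elim (separated⇒distinct qt st e)
    injective {suc zero} {suc (suc (suc (suc zero)))} e = ⊥-elim (separated⇒distinct qs (flip st) e)
    injective {suc (suc zero)} {zero} e = ⊥-elim (p≢r (sym e))
    injective {suc (suc zero)} {suc zero} e = ⊥-elim (adjacent⇒distinct qr (sym e))
    injective {suc (suc zero)} {suc (suc zero)} _ = refl
    injective {suc (suc zero)} {suc (suc (suc zero))} e = ⊥-elim (separated⇒distinct rt st e)
    injective {suc (suc zero)} {suc (suc (suc (suc zero)))} e = ⊥-elim (separated⇒distinct rs (flip st) e)
    injective {suc (suc (suc zero))} {zero} e = ⊥-elim (separated⇒distinct pt st (sym e))
    injective {suc (suc (suc zero))} {suc zero} e = ⊥-elim (separated⇒distinct qt st (sym e))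
    injective {suc (suc (suc zero))} {suc (suc zero)} e = ⊥-elim (separated⇒distinct rt st (sym e))
    injective {suc (suc (suc zero))} {suc (suc (suc zero))} _ = refl
    injective {suc (suc (suc zero))} {suc (suc (suc (suc zero)))} e = ⊥-elim (adjacent⇒distinct st e)
    injective {suc (suc (suc (suc zero)))} {zero} e = ⊥-elim (separated⇒distinct ps (flip st) (sym e))
    injective {suc (suc (suc (suc zero)))} {suc zero} e = ⊥-elim (separated⇒distinct qs (flip st) (sym e))
    injective {suc (suc (suc (suc zero)))} {suc (suc zero)} e = ⊥-elim (separated⇒distinct rs (flip st) (sym e))
    injective {suc (suc (suc (suc zero)))} {suc (suc (suc zero))} e = ⊥-elim (adjacent⇒distinct st (sym e))
    injective {suc (suc (suc (suc zero)))} {suc (suc (suc (suc zero)))} _ = refl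

    preserves : ∀ x y → adj P₃+P₂ x y ≡ adj G (f x) (f y)
    preserves zero zero = sym (loopless G p)
    preserves zero (suc zero) = sym pq
    preserves zero (suc (suc zero)) = sym pr
    preserves zero (suc (suc (suc zero))) = sym ps
    preserves zero (suc (suc (suc (suc zero)))) = sym pt
    preserves (suc zero) zero = sym (flip pq)
    preserves (suc zero) (suc zero) = sym (loopless G q)
    preserves (suc zero) (suc (suc zero)) = sym qr
    preserves (suc zero) (suc (suc (suc zero))) = sym qs
    preserves (suc zero) (suc (suc (suc (suc zero)))) = sym qt
    preserves (suc (suc zero)) zero = sym (flip pr)
    preserves (suc (suc zero)) (suc zero) = sym (flip qr)
    preserves (suc (suc zero)) (suc (suc zero)) = sym (loopless G r)
    preserves (suc (suc zero)) (suc (suc (suc zero))) = sym rs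
    preserves (suc (suc zero)) (suc (suc (suc (suc zero)))) = sym rt
    preserves (suc (suc (suc zero))) zero = sym (flip ps)
    preserves (suc (suc (suc zero))) (suc zero) = sym (flip qs)
    preserves (suc (suc (suc zero))) (suc (suc zero)) = sym (flip rs)
    preserves (suc (suc (suc zero))) (suc (suc (suc zero))) = sym (loopless G s)
    preserves (suc (suc (suc zero))) (suc (suc (suc (suc zero)))) = sym st
    preserves (suc (suc (suc (suc zero)))) zero = sym (flip pt)
    preserves (suc (suc (suc (suc zero)))) (suc zero) = sym (flip qt)
    preserves (suc (suc (suc (suc zero)))) (suc (suc zero)) = sym (flip rt)
    preserves (suc (suc (suc (suc zero)))) (suc (suc (suc zero))) = sym (flip st)
    preserves (suc (suc (suc (suc zero)))) (suc (suc (suc (suc zero)))) = sym (loopless G t)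

  module _ {P : Fin (n G) → Set} where

    Reach-snoc : ∀ {u v x} → Reach G P u v → adj G v x ≡ true → P x → Reach G P u x
    Reach-snoc here vx px = step vx px here
    Reach-snoc (step e pv r) vx px = step e pv (Reach-snoc r vx px)

    Reach-reverse : ∀ {u v} → Reach G P u v → P u → Reach G P v u
    Reach-reverse here _ = here
    Reach-reverse (step e pv r) pu = Reach-snoc (Reach-reverse r pv) (flip e) pu

    Reach-++ : ∀ {u v x} → Reach G P u v → Reach G P v x → Reach G P u x
    Reach-++ here r = r
    Reach-++ (step e pv r) r' = step e pv (Reach-++ r r')

    isolated-alone : ∀ {C r u} → IsComponentOf G P C → r ∈ C → u ∈ C →
                     (∀ y → P y → adj G r y ≡ false) → u ≡ r
    isolated-alone (_ , _ , reach , _) r∈C u∈C no-nbr with reach _ _ r∈C u∈C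
    ... | here = refl
    ... | step {v = y} e py _ = contradiction (trans (sym (no-nbr y py)) e) λ ()

-- Every vertex of a decidable set P lies in a component of G[P]: grow
-- {w} by adjacent P-vertices until nothing changes.
module Components (G : Graph) {P : Fin (n G) → Set} (P? : Decidable P) where

  Grow : Subset (n G) → Fin (n G) → Set
  Grow T x = x ∈ T ⊎ (P x × ∃ λ y → y ∈ T × adj G y x ≡ true)

  grow? : ∀ T → Decidable (Grow T)
  grow? T x = x ∈? T ⊎-dec (P? x ×-dec any? (λ y → y ∈? T ×-dec (adj G y x ≟ᵇ true)))

  grow : Subset (n G) → Subset (n G)
  grow T = ⟦ grow? T ⟧

  ReachedFrom : Fin (n G) → Subset (n G) → Set
  ReachedFrom w T = w ∈ T × (∀ x → x ∈ T → P x × Reach G P w x)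

  reached-grow : ∀ {w T} → ReachedFrom w T → ReachedFrom w (grow T)
  reached-grow {w} {T} (w∈T , reached) = ∈⟦⟧⁺ (grow? T) (inj₁ w∈T) , extend
    where
    extend : ∀ x → x ∈ grow T → P x × Reach G P w x
    extend x x∈ with ∈⟦⟧⁻ (grow? T) x∈
    ... | inj₁ x∈T = reached x x∈T
    ... | inj₂ (px , y , y∈T , yx) = px , Reach-snoc G (proj₂ (reached y y∈T)) yx px

  component-of : ∀ w → P w → Σ (Subset (n G)) λ K → IsComponentOf G P K × w ∈ K
  component-of w pw with stabilise grow (λ T x∈T → ∈⟦⟧⁺ (grow? T) (inj₁ x∈T)) (ReachedFrom w)
                                   reached-grow ⁅ w ⁆ (x∈⁅x⁆ w , start)
    where
    start : ∀ x → x ∈ ⁅ w ⁆ → P x × Reach G P w x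
    start x x∈ with x∈⁅y⁆⇒x≡y w x∈
    ... | refl = pw , here
  ... | K , (w∈K , reached) , closed =
        K , ((λ v v∈K → proj₁ (reached v v∈K)) , (w , w∈K) , connected , maximal) , w∈K
    where
    connected : ∀ u v → u ∈ K → v ∈ K → Reach G P u v
    connected u v u∈K v∈K = Reach-++ G (Reach-reverse G (proj₂ (reached u u∈K)) pw) (proj₂ (reached v v∈K))
    maximal : ∀ u v → u ∈ K → P v → adj G u v ≡ true → v ∈ K
    maximal u v u∈K pv uv = closed (∈⟦⟧⁺ (grow? K) (inj₂ (pv , u , u∈K , uv)))

module _ (G : Graph) {A' B' : Fin (n G) → Set} where

  Candidate : Subset (n G) → Set
  Candidate S = (∀ a → a ∈ S → A' a) × Dominates G B' S

  candidate? : Decidable A' → Decidable B' → Decidable Candidate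
  candidate? A? B? S = all? (λ a → a ∈? S →-dec A? a)
                       ×-dec all? (λ v → B? v →-dec any? (λ a → a ∈? S ×-dec (adj G a v ≟ᵇ true)))

  γ''-least : ∀ {S} → Candidate S → (∀ T → Candidate T → ∣ S ∣ ≤ ∣ T ∣) → IsGamma'' G A' B' (fin ∣ S ∣)
  γ''-least {S} (S⊆A' , dom) least =
    (λ { x (T , T⊆A' , domT , refl) → fin≤fin (least T (T⊆A' , domT)) }) , inj₁ (S , S⊆A' , dom , refl)

  γ''-none : (∀ S → ¬ Candidate S) → IsGamma'' G A' B' ∞
  γ''-none none = (λ { x (T , T⊆A' , domT , _) → ⊥-elim (none T (T⊆A' , domT)) }) , inj₂ refl

  candidates-mono : ∀ {A'' : Fin (n G) → Set} → (∀ a → A' a → A'' a) →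
                    ∀ x → γ''-candidates G A' B' x → γ''-candidates G A'' B' x
  candidates-mono A'⊆A'' x (S , S⊆A' , dom , x≡) = S , (λ a a∈S → A'⊆A'' a (S⊆A' a a∈S)) , dom , x≡

_≟ˡ_ : (x y : Lab) → Dec (x ≡ y)
a₁ ≟ˡ a₁ = yes refl
a₁ ≟ˡ a₂ = no λ ()
a₁ ≟ˡ a₃ = no λ ()
a₁ ≟ˡ lB = no λ ()
a₂ ≟ˡ a₁ = no λ ()
a₂ ≟ˡ a₂ = yes refl
a₂ ≟ˡ a₃ = no λ ()
a₂ ≟ˡ lB = no λ ()
a₃ ≟ˡ a₁ = no λ ()
a₃ ≟ˡ a₂ = no λ ()
a₃ ≟ˡ a₃ = yes refl
a₃ ≟ˡ lB = no λ ()
lB ≟ˡ a₁ = no λ ()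
lB ≟ˡ a₂ = no λ ()
lB ≟ˡ a₃ = no λ ()
lB ≟ˡ lB = yes refl

-- The argument for a fixed graph G(A,B) that is (P₃+P₂)-free, has B
-- independent, and has no A-vertex whose B-neighbourhood contains that of
-- another.  These are the only parts of irreducibility that are used.

module Relocation (G : Graph) (lab : Fin (n G) → Lab) (free : ¬ (P₃+P₂ ≤ᵢ G))
                  (B-indep : ∀ u v → InB G lab u → InB G lab v → adj G u v ≡ false)
                  (A-noninc : ∀ u v → InA G lab u → InA G lab v → u ≢ v →
                              ¬ (∀ w → ¬ InA G lab w → adj G u w ≡ true → adj G v w ≡ true)) where

  A₁ : Fin (n G) → Set
  A₁ = InA₁ G lab

  inB? : Decidable (InB G lab)
  inB? x = lab x ≟ˡ lB

  inA? : Decidable (InA G lab)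
  inA? x = ¬? (inB? x)

  inA₁? : Decidable A₁
  inA₁? x = lab x ≟ˡ a₁

  A₁⊆A : ∀ {a} → A₁ a → InA G lab a
  A₁⊆A a∈A₁ a∈B with trans (sym a∈A₁) a∈B
  ... | ()

  private-neighbour : ∀ u v → InA G lab u → InA G lab v → u ≢ v →
                      ∃ λ s → InB G lab s × adj G u s ≡ true × adj G v s ≡ false
  private-neighbour u v u∈A v∈A u≢v
    with any? (λ s → inB? s ×-dec (adj G u s ≟ᵇ true) ×-dec (adj G v s ≟ᵇ false))
  ... | yes found = found
  ... | no none = ⊥-elim (A-noninc u v u∈A v∈A u≢v included)
    where
    included : ∀ w → ¬ InA G lab w → adj G u w ≡ true → adj G v w ≡ true
    included w w∉A uw = decidable-stable (adj G v w ≟ᵇ true) λ vw≢true →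
      none (w , decidable-stable (inB? w) w∉A , uw , ¬-not vw≢true)

  -- Otherwise take a private
  -- neighbour s of u over v: if a ≁ s then v-u-s, a-b induce P₃+P₂; if a ~ s,
  -- a private neighbour d of v over a gives the induced P₃+P₂ b-a-s, v-d.
  edge-dominates : ∀ u v a b → InA G lab u → InA G lab v → InA G lab a →
                   adj G u v ≡ true → adj G a u ≡ false → adj G a v ≡ false →
                   InB G lab b → adj G a b ≡ true → adj G u b ≡ true ⊎ adj G v b ≡ true
  edge-dominates u v a b u∈A v∈A a∈A uv au av b∈B ab with adj G u b in ub | adj G v b in vb
  ... | true | _ = inj₁ refl
  ... | false | true = inj₂ refl
  ... | false | false with private-neighbour u v u∈A v∈A (adjacent⇒distinct G uv)
  ...   | s , s∈B , us , vs with adj G a s in as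
  ...     | false = ⊥-elim (free (induced-P₃+P₂ G v u s a b v≢s (flip G uv) us vs ab
                                    (flip G av) vb (flip G au) ub (flip G as) (B-indep s b s∈B b∈B)))
    where
    v≢s : v ≢ s
    v≢s refl = v∈A s∈B
  ...     | true with private-neighbour v a v∈A a∈A (λ v≡a → separated⇒distinct G au (flip G uv) (sym v≡a))
  ...       | d , d∈B , vd , ad =
              ⊥-elim (free (induced-P₃+P₂ G b a s v d (separated⇒distinct G (flip G ub) (flip G us))
                              (flip G ab) as (B-indep b s b∈B s∈B) vd (flip G vb) (B-indep b d b∈B d∈B)
                              av ad (flip G vs) (B-indep s d s∈B d∈B)))

  AK? : ∀ K → Decidable (AK G lab K)
  AK? K x = x ∈? K ⊎-dec (lab x ≟ˡ a₂ ⊎-dec lab x ≟ˡ a₃)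

  AK-set : Subset (n G) → Subset (n G)
  AK-set K = ⟦ AK? K ⟧

  AK⊆A : ∀ {K} → IsComponentOf G A₁ K → ∀ a → AK G lab K a → InA G lab a
  AK⊆A (K⊆A₁ , _) a (inj₁ a∈K) = A₁⊆A (K⊆A₁ a a∈K)
  AK⊆A _ a (inj₂ (inj₁ a∈A₂)) a∈B with trans (sym a∈A₂) a∈B
  ... | ()
  AK⊆A _ a (inj₂ (inj₂ a∈A₃)) a∈B with trans (sym a∈A₃) a∈B
  ... | ()

  outside-AK : ∀ {K a} → InA G lab a → ¬ AK G lab K a → A₁ a × a ∉ K
  outside-AK {K} {a} a∈A a∉AK with lab a
  ... | a₁ = refl , λ a∈K → a∉AK (inj₁ a∈K)
  ... | a₂ = ⊥-elim (a∉AK (inj₂ (inj₁ refl)))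
  ... | a₃ = ⊥-elim (a∉AK (inj₂ (inj₂ refl)))
  ... | lB = ⊥-elim (a∈A refl)

  AK∩A₁⊆K : ∀ {K r} → A₁ r → AK G lab K r → r ∈ K
  AK∩A₁⊆K _ (inj₁ r∈K) = r∈K
  AK∩A₁⊆K r∈A₁ (inj₂ (inj₁ r∈A₂)) with trans (sym r∈A₁) r∈A₂
  ... | ()
  AK∩A₁⊆K r∈A₁ (inj₂ (inj₂ r∈A₃)) with trans (sym r∈A₁) r∈A₃
  ... | ()

  within-AK : ∀ {K S} → (∀ a → a ∈ S → InA G lab a) → (∀ a → a ∈ S → A₁ a → a ∈ K) →
              ∀ a → a ∈ S → AK G lab K a
  within-AK {K} S⊆A A₁∩S⊆K a a∈S with AK? K a
  ... | yes a∈AK = a∈AK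
  ... | no a∉AK with outside-AK (S⊆A a a∈S) a∉AK
  ...   | a∈A₁ , a∉K = ⊥-elim (a∉K (A₁∩S⊆K a a∈S a∈A₁))

  Dominating : Subset (n G) → Set
  Dominating = Candidate G {InA G lab} {InB G lab}

  Dominating-K : Subset (n G) → Subset (n G) → Set
  Dominating-K K = Candidate G {AK G lab K} {InB G lab}

  -- The exchange: for an edge uv of a component K of G[A₁], any set
  -- containing u, v and S ∩ (V(K) ∪ A₂ ∪ A₃) dominates B if S does, since
  -- the dropped vertices lie in A₁ ∖ K and so see neither u nor v.
  exchange-dominates : ∀ {K u v S S'} → IsComponentOf G A₁ K → u ∈ K → v ∈ K → adj G u v ≡ true →
                       Dominating S → S ∩ AK-set K ⊆ S' → u ∈ S' → v ∈ S' → Dominates G (InB G lab) S'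
  exchange-dominates {K} {u} {v} (K⊆A₁ , _ , _ , maximal) u∈K v∈K uv (S⊆A , dom) kept u∈S' v∈S' b b∈B
    with dom b b∈B
  ... | a , a∈S , ab with AK? K a
  ...   | yes a∈AK = a , kept (x∈p∩q⁺ (a∈S , ∈⟦⟧⁺ (AK? K) a∈AK)) , ab
  ...   | no a∉AK with outside-AK (S⊆A a a∈S) a∉AK
  ...     | a∈A₁ , a∉K with edge-dominates u v a b (A₁⊆A (K⊆A₁ u u∈K)) (A₁⊆A (K⊆A₁ v v∈K))
                                            (S⊆A a a∈S) uv (far u u∈K) (far v v∈K) b∈B ab
    where
    far : ∀ x → x ∈ K → adj G a x ≡ false
    far x x∈K = ¬-not λ ax → a∉K (maximal x a x∈K a∈A₁ (flip G ax))
  ...       | inj₁ ub = u , u∈S' , ub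
  ...       | inj₂ vb = v , v∈S' , vb

  kept-in-AK : ∀ {K S} a → a ∈ S ∩ AK-set K → AK G lab K a
  kept-in-AK {K} {S} a a∈ = ∈⟦⟧⁻ (AK? K) (proj₂ (x∈p∩q⁻ S (AK-set K) a∈))

  add-in-AK : ∀ {K T} x → (∀ a → a ∈ T → AK G lab K a) → x ∈ K → ∀ a → a ∈ T ∪ ⁅ x ⁆ → AK G lab K a
  add-in-AK {T = T} x T⊆AK x∈K a a∈ with ∈∪⁅⁆⁻ T a∈
  ... | inj₁ a∈T = T⊆AK a a∈T
  ... | inj₂ refl = inj₁ x∈K

  Relocated : Subset (n G) → Set
  Relocated S = Σ (Subset (n G)) λ K → Σ (Subset (n G)) λ S' →
                IsComponentOf G A₁ K × Dominating-K K S' × ∣ S' ∣ ≤ ∣ S ∣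

  stay : ∀ {K S} → IsComponentOf G A₁ K → Dominating S → (∀ a → a ∈ S → AK G lab K a) → Relocated S
  stay {K} {S} K-comp (_ , dom) S⊆AK = K , S , K-comp , (S⊆AK , dom) , ≤-reflexive refl

  exchange-one : ∀ {K S t z r} → IsComponentOf G A₁ K → Dominating S → t ∈ S → t ∈ K → z ∈ K →
                 adj G t z ≡ true → r ∈ S → ¬ AK G lab K r → Relocated S
  exchange-one {K} {S} {z = z} {r} K-comp S-dom t∈S t∈K z∈K tz r∈S r∉AK =
    K , S' , K-comp , (add-in-AK z kept-in-AK z∈K , dom) , size
    where
    S' : Subset (n G)
    S' = (S ∩ AK-set K) ∪ ⁅ z ⁆
    dom : Dominates G (InB G lab) S'
    dom = exchange-dominates K-comp t∈K z∈K tz S-dom (λ a∈ → x∈p∪q⁺ (inj₁ a∈))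
            (x∈p∪q⁺ (inj₁ (x∈p∩q⁺ (t∈S , ∈⟦⟧⁺ (AK? K) (inj₁ t∈K))))) (x∈p∪q⁺ (inj₂ (x∈⁅x⁆ z)))
    size : ∣ S' ∣ ≤ ∣ S ∣
    size = ≤-trans (∣p∪⁅x⁆∣≤1+∣p∣ (S ∩ AK-set K) z)
                   (p⊂q⇒∣p∣<∣q∣ ((λ a∈ → proj₁ (x∈p∩q⁻ S _ a∈)) , r , r∈S ,
                                 λ r∈ → r∉AK (kept-in-AK r r∈)))

  exchange-two : ∀ {K S u v r₁ r₂} → IsComponentOf G A₁ K → Dominating S → u ∈ K → v ∈ K →
                 adj G u v ≡ true → r₁ ≢ r₂ → r₁ ∈ S → r₂ ∈ S →
                 ¬ AK G lab K r₁ → ¬ AK G lab K r₂ → Relocated S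
  exchange-two {K} {S} {u} {v} K-comp S-dom u∈K v∈K uv r₁≢r₂ r₁∈S r₂∈S r₁∉AK r₂∉AK =
    K , S' , K-comp , (add-in-AK v (add-in-AK u kept-in-AK u∈K) v∈K , dom) , size
    where
    S' : Subset (n G)
    S' = ((S ∩ AK-set K) ∪ ⁅ u ⁆) ∪ ⁅ v ⁆
    dom : Dominates G (InB G lab) S'
    dom = exchange-dominates K-comp u∈K v∈K uv S-dom (λ a∈ → x∈p∪q⁺ (inj₁ (x∈p∪q⁺ (inj₁ a∈))))
            (x∈p∪q⁺ (inj₁ (x∈p∪q⁺ (inj₂ (x∈⁅x⁆ u))))) (x∈p∪q⁺ (inj₂ (x∈⁅x⁆ v)))
    size : ∣ S' ∣ ≤ ∣ S ∣
    size = ≤-trans (∣p∪⁅x⁆∣≤1+∣p∣ ((S ∩ AK-set K) ∪ ⁅ u ⁆) v)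
             (≤-trans (s≤s (∣p∪⁅x⁆∣≤1+∣p∣ (S ∩ AK-set K) u))
                      (2+∣p∣≤∣q∣ (λ a∈ → proj₁ (x∈p∩q⁻ S _ a∈)) r₁≢r₂ r₁∈S r₂∈S
                                 (λ r∈ → r₁∉AK (kept-in-AK _ r∈)) (λ r∈ → r₂∉AK (kept-in-AK _ r∈))))

  open Components G inA₁?

  relocate-at-edge : ∀ {S t z} → Dominating S → t ∈ S → A₁ t → A₁ z → adj G t z ≡ true → Relocated S
  relocate-at-edge {S} {t} {z} S-dom t∈S t∈A₁ z∈A₁ tz with component-of t t∈A₁
  ... | K , K-comp@(_ , _ , _ , maximal) , t∈K with any? (λ r → r ∈? S ×-dec ¬? (AK? K r))
  ...   | yes (r , r∈S , r∉AK) = exchange-one K-comp S-dom t∈S t∈K (maximal t z t∈K z∈A₁ tz) tz r∈S r∉AK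
  ...   | no S⊆AK = stay K-comp S-dom λ a a∈S → decidable-stable (AK? K a) (λ a∉AK → S⊆AK (a , a∈S , a∉AK))

  -- Every A₁-vertex of S is isolated in G[A₁], and u₀v₀ is an edge of
  -- G[A₁].  Two such vertices lie outside the component of u₀ and are
  -- exchanged for u₀, v₀; a single one is a component by itself; if there
  -- is none, S fits the component of u₀.
  relocate-isolated : ∀ {S u₀ v₀} → Dominating S → A₁ u₀ → A₁ v₀ → adj G u₀ v₀ ≡ true →
                      (∀ r → r ∈ S → A₁ r → ∀ y → A₁ y → adj G r y ≡ false) → Relocated S
  relocate-isolated {S} {u₀} {v₀} S-dom u₀∈A₁ v₀∈A₁ u₀v₀ isolated with component-of u₀ u₀∈A₁
  ... | K , K-comp@(_ , _ , _ , maximal) , u₀∈K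
    with any? (λ r₁ → any? (λ r₂ → (r₁ ∈? S ×-dec inA₁? r₁) ×-dec (r₂ ∈? S ×-dec inA₁? r₂) ×-dec ¬? (r₁ ≟ᶠ r₂)))
  ...   | yes (r₁ , r₂ , (r₁∈S , r₁∈A₁) , (r₂∈S , r₂∈A₁) , r₁≢r₂) =
          exchange-two K-comp S-dom u₀∈K (maximal u₀ v₀ u₀∈K v₀∈A₁ u₀v₀) u₀v₀
                       r₁≢r₂ r₁∈S r₂∈S (outside-K r₁∈S r₁∈A₁) (outside-K r₂∈S r₂∈A₁)
    where
    -- u₀ has the A₁-neighbour v₀, so an isolated r cannot share its component.
    outside-K : ∀ {r} → r ∈ S → A₁ r → ¬ AK G lab K r
    outside-K {r} r∈S r∈A₁ r∈AK with isolated-alone G K-comp (AK∩A₁⊆K r∈A₁ r∈AK) u₀∈K (isolated r r∈S r∈A₁)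
    ... | refl = contradiction (trans (sym (isolated r r∈S r∈A₁ v₀ v₀∈A₁)) u₀v₀) λ ()
  ...   | no at-most-one with any? (λ r → r ∈? S ×-dec inA₁? r)
  ...     | no none = stay K-comp S-dom (within-AK (proj₁ S-dom) λ a a∈S a∈A₁ → ⊥-elim (none (a , a∈S , a∈A₁)))
  ...     | yes (r , r∈S , r∈A₁) with component-of r r∈A₁
  ...       | Kᵣ , Kᵣ-comp , r∈Kᵣ = stay Kᵣ-comp S-dom (within-AK (proj₁ S-dom) only-r)
    where
    only-r : ∀ a → a ∈ S → A₁ a → a ∈ Kᵣ
    only-r a a∈S a∈A₁ with a ≟ᶠ r
    ... | yes refl = r∈Kᵣ
    ... | no a≢r = ⊥-elim (at-most-one (a , r , (a∈S , a∈A₁) , (r∈S , r∈A₁) , a≢r))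

  relocate : ∀ {u₀ v₀} → A₁ u₀ → A₁ v₀ → adj G u₀ v₀ ≡ true → ∀ S → Dominating S → Relocated S
  relocate u₀∈A₁ v₀∈A₁ u₀v₀ S S-dom
    with any? (λ t → t ∈? S ×-dec inA₁? t ×-dec any? (λ z → inA₁? z ×-dec (adj G t z ≟ᵇ true)))
  ... | yes (t , t∈S , t∈A₁ , z , z∈A₁ , tz) = relocate-at-edge S-dom t∈S t∈A₁ z∈A₁ tz
  ... | no no-edge-at-S = relocate-isolated S-dom u₀∈A₁ v₀∈A₁ u₀v₀ λ r r∈S r∈A₁ y y∈A₁ →
                            ¬-not λ ry → no-edge-at-S (r , r∈S , r∈A₁ , y , y∈A₁ , ry)

  component-values-above : ∀ {g} → (∀ x → γ''-candidates G (InA G lab) (InB G lab) x → g ≤∞ x) →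
                           ∀ x → ComponentValues G lab x → g ≤∞ x
  component-values-above below x (_ , K-comp , _ , (_ , inj₁ x-cand)) =
    below x (candidates-mono G (AK⊆A K-comp) x x-cand)
  component-values-above below x (_ , _ , _ , (_ , inj₂ refl)) = _ ≤∞∞

  -- Lemma 6 when G[A₁] has an edge u₀v₀: relocating a smallest dominating
  -- S ⊆ A gives a component K with γ''(G_K) = |S| = γ''(G), and K satisfies
  -- N_B(V(K) ∪ A₂ ∪ A₃) = B because the relocated set dominates B.
  γ''-by-components : ∀ {u₀ v₀} → A₁ u₀ → A₁ v₀ → adj G u₀ v₀ ≡ true →
                      ∃ λ g → IsGamma'' G (InA G lab) (InB G lab) g × IsMinimum (ComponentValues G lab) g
  γ''-by-components u₀∈A₁ v₀∈A₁ u₀v₀ with least-witness (candidate? G inA? inB?)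
  ... | inj₁ none = ∞ , γ''-none G none , component-values-above (proj₁ (γ''-none G none)) , inj₂ refl
  ... | inj₂ (S , S-dom , S-least) with relocate u₀∈A₁ v₀∈A₁ u₀v₀ S S-dom
  ...   | K , S' , K-comp , (S'⊆AK , S'-dom) , S'≤S =
          fin ∣ S ∣ , γ , component-values-above (proj₁ γ) , inj₁ (K , K-comp , covers , γ-K)
    where
    γ : IsGamma'' G (InA G lab) (InB G lab) (fin ∣ S ∣)
    γ = γ''-least G S-dom S-least
    same-size : ∣ S ∣ ≡ ∣ S' ∣
    same-size = ≤-antisym (S-least S' ((λ a a∈ → AK⊆A K-comp a (S'⊆AK a a∈)) , S'-dom)) S'≤S
    γ-K : IsGamma'' G (AK G lab K) (InB G lab) (fin ∣ S ∣)
    γ-K = (λ x x-cand → proj₁ γ x (candidates-mono G (AK⊆A K-comp) x x-cand))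
        , inj₁ (S' , S'⊆AK , S'-dom , cong fin same-size)
    covers : CoversAll G (InB G lab) (AK G lab K)
    covers v = proj₁ , λ v∈B → v∈B , neighbour v∈B
      where
      neighbour : InB G lab v → ∃ λ a → AK G lab K a × adj G a v ≡ true
      neighbour v∈B with S'-dom v v∈B
      ... | a , a∈S' , av = a , S'⊆AK a a∈S' , av

lemma6 : (X : GraphClass) → Hereditary X → X ⊆ᶜ Free₁ P₃+P₂ →
         (G : Graph) → (lab : Fin (n G) → Lab) → IrreducibleVia X G lab →
         A₁-Independent G lab ⊎
         (∃ λ g → IsGamma'' G (InA G lab) (InB G lab) g × IsMinimum (ComponentValues G lab) g)
lemma6 X _ X⊆free G lab irr
  with any? (λ u → any? (λ v → (lab u ≟ˡ a₁) ×-dec (lab v ≟ˡ a₁) ×-dec (adj G u v ≟ᵇ true)))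
... | yes (u , v , u∈A₁ , v∈A₁ , uv) =
      inj₂ (Relocation.γ''-by-components G lab (X⊆free G (IrreducibleVia.inX irr))
              (IrreducibleVia.B-indep irr) (IrreducibleVia.A-noninc irr) u∈A₁ v∈A₁ uv)
... | no no-edge = inj₁ λ u v u∈A₁ v∈A₁ → ¬-not λ uv → no-edge (u , v , u∈A₁ , v∈A₁ , uv)
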